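{- If $P$ is a plain Presburger group, then there exists a divisible ordered abelian group $V$ such that $P\cong V\times\mathbb{Z}$.
   Context: A Presburger group is a model of the first-order theory of $(\mathbb{Z},+,<,0,1)$. For an element $a$ of a Presburger group and a positive integer $n$, $a \bmod n$ is the unique $r\in\{0,\dots,n-1\}$ with $a=ny+r\cdot 1$ for some $y$; the residue sequence of $a$ is $\rho(a)=(a\bmod 1,a\bmod 2,a\bmod 3,\dots)$. $P$ is plain if for every $x\in P$ there is an integer $z$ (i.e.\ $z\cdot 1$ or $-(|z|\cdot 1)$ in $P$) with $\rho(x)=\rho(z)$. A divisible ordered abelian group is a totally ordered abelian group $V$ in which every element is divisible by every positive integer. $V\times\mathbb{Z}$ has coordinatewise addition, lexicographic order (first coordinate most significant), $0=(0_V,0)$ and $1=(0_V,1)$; the isomorphism is of structures in the language $(+,<,0,1)$. -}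

module Defs where

open import Level using (Level; suc; _⊔_; 0ℓ; Lift)
open import Data.Nat as ℕ using (ℕ; zero)
open import Data.Fin using (Fin) renaming (zero to fz; suc to fs)
open import Data.Integer as ℤ using (ℤ; +_; -[1+_])
import Data.Integer.Properties as ℤP
open import Data.Product using (Σ; _×_; _,_; ∃)
open import Data.Sum using (_⊎_)
open import Data.Empty.Polymorphic using (⊥)
open import Relation.Binary.PropositionalEquality using (_≡_)
open import Relation.Nullary using (¬_)
open import Function.Bundles using (_⇔_)

record Structure (ℓ : Level) : Set (suc ℓ) where
  field
    Carrier : Set ℓ
    _⊕_     : Carrier → Carrier → Carrier
    _≺_     : Carrier → Carrier → Set ℓ
    𝟘       : Carrier
    𝟙       : Carrier

data Term (n : ℕ) : Set where
  var  : Fin n → Term n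
  `0   : Term n
  `1   : Term n
  _`+_ : Term n → Term n → Term n

data Formula : ℕ → Set where
  _`≈_ : ∀ {n} → Term n → Term n → Formula n
  _`<_ : ∀ {n} → Term n → Term n → Formula n
  `⊥   : ∀ {n} → Formula n
  _`⇒_ : ∀ {n} → Formula n → Formula n → Formula n
  _`∧_ : ∀ {n} → Formula n → Formula n → Formula n
  _`∨_ : ∀ {n} → Formula n → Formula n → Formula n
  `∀   : ∀ {n} → Formula (ℕ.suc n) → Formula n
  `∃   : ∀ {n} → Formula (ℕ.suc n) → Formula n

Sentence : Set
Sentence = Formula 0

module _ {ℓ : Level} (M : Structure ℓ) where
  open Structure M

  Env : ℕ → Set ℓ
  Env n = Fin n → Carrier

  extend : ∀ {n} → Carrier → Env n → Env (ℕ.suc n)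
  extend a ρ fz     = a
  extend a ρ (fs i) = ρ i

  evalT : ∀ {n} → Env n → Term n → Carrier
  evalT ρ (var i)  = ρ i
  evalT ρ `0       = 𝟘
  evalT ρ `1       = 𝟙
  evalT ρ (s `+ t) = evalT ρ s ⊕ evalT ρ t

  Sat : ∀ {n} → Env n → Formula n → Set ℓ
  Sat ρ (s `≈ t) = evalT ρ s ≡ evalT ρ t
  Sat ρ (s `< t) = evalT ρ s ≺ evalT ρ t
  Sat ρ `⊥       = ⊥
  Sat ρ (φ `⇒ ψ) = Sat ρ φ → Sat ρ ψ
  Sat ρ (φ `∧ ψ) = Sat ρ φ × Sat ρ ψ
  Sat ρ (φ `∨ ψ) = Sat ρ φ ⊎ Sat ρ ψ
  Sat ρ (`∀ φ)   = (a : Carrier) → Sat (extend a ρ) φ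
  Sat ρ (`∃ φ)   = Σ Carrier λ a → Sat (extend a ρ) φ

  emptyEnv : Env 0
  emptyEnv ()

  _⊨_ : Sentence → Set ℓ
  _⊨_ φ = Sat emptyEnv φ

ℤ-structure : Structure 0ℓ
ℤ-structure = record
  { Carrier = ℤ ; _⊕_ = ℤ._+_ ; _≺_ = ℤ._<_ ; 𝟘 = + 0 ; 𝟙 = + 1 }

IsPresburger : ∀ {ℓ} → Structure ℓ → Set ℓ
IsPresburger {ℓ} P = (φ : Sentence) → _⊨_ ℤ-structure φ → _⊨_ P φ

module _ {ℓ : Level} (P : Structure ℓ) where
  open Structure P

  _·_ : ℕ → Carrier → Carrier
  zero · y     = 𝟘
  ℕ.suc n · y  = y ⊕ (n · y)

  HasResidue : (n : ℕ) → Carrier → ℕ → Set ℓ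
  HasResidue n a r = Σ Carrier λ y → a ≡ (n · y) ⊕ (r · 𝟙)

  SameResidues : Carrier → Carrier → Set ℓ
  SameResidues a b = (n : ℕ) → 0 ℕ.< n → (r : ℕ) → r ℕ.< n →
                     (HasResidue n a r ⇔ HasResidue n b r)

  -- w is the interpretation in P of the integer z:
  --   z ≥ 0 : w = z·1 ;  z = -(k+1) : w + (k+1)·1 = 0, i.e. w = -((k+1)·1)
  IsIntegerElem : ℤ → Carrier → Set ℓ
  IsIntegerElem (+ k)     w = w ≡ k · 𝟙
  IsIntegerElem -[1+ k ]  w = w ⊕ (ℕ.suc k · 𝟙) ≡ 𝟘

  Plain : Set ℓ
  Plain = (x : Carrier) → Σ ℤ λ z → Σ Carrier λ w →
            IsIntegerElem z w × SameResidues x w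

times : ∀ {a} {A : Set a} → (A → A → A) → A → ℕ → A → A
times _+_ 0# zero    y = 0#
times _+_ 0# (ℕ.suc n) y = y + times _+_ 0# n y

record DivisibleOrderedAbelianGroup (ℓ : Level) : Set (suc ℓ) where
  field
    Carrier : Set ℓ
    _+_     : Carrier → Carrier → Carrier
    0#      : Carrier
    -_      : Carrier → Carrier
    _<_     : Carrier → Carrier → Set ℓ
    +-assoc     : ∀ x y z → (x + y) + z ≡ x + (y + z)
    +-comm      : ∀ x y → x + y ≡ y + x
    +-identityˡ : ∀ x → 0# + x ≡ x
    -‿inverseˡ  : ∀ x → (- x) + x ≡ 0#
    <-irrefl    : ∀ x → ¬ (x < x)
    <-trans     : ∀ {x y z} → x < y → y < z → x < z
    <-trichotomy : ∀ x y → x < y ⊎ x ≡ y ⊎ y < x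
    +-mono-<    : ∀ {x y} z → x < y → (x + z) < (y + z)
    divisible   : ∀ (n : ℕ) → 0 ℕ.< n → ∀ x →
                  Σ Carrier λ y → times _+_ 0# n y ≡ x

_×ℤ : ∀ {ℓ} → DivisibleOrderedAbelianGroup ℓ → Structure ℓ
_×ℤ {ℓ} V = record
  { Carrier = Carrier × ℤ
  ; _⊕_ = λ { (v , a) (w , b) → (v + w , a ℤ.+ b) }
  ; _≺_ = λ { (v , a) (w , b) → (v < w) ⊎ (v ≡ w × Lift ℓ (a ℤ.< b)) }
  ; 𝟘 = (0# , + 0)
  ; 𝟙 = (0# , + 1)
  }
  where open DivisibleOrderedAbelianGroup V

record _≅_ {ℓ ℓ'} (M : Structure ℓ) (N : Structure ℓ') : Set (ℓ ⊔ ℓ') where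
  private
    module M = Structure M
    module N = Structure N
  field
    to       : M.Carrier → N.Carrier
    from     : N.Carrier → M.Carrier
    from∘to  : ∀ x → from (to x) ≡ x
    to∘from  : ∀ y → to (from y) ≡ y
    pres-+   : ∀ x y → to (x M.⊕ y) ≡ (to x N.⊕ to y)
    pres-0   : to M.𝟘 ≡ N.𝟘
    pres-1   : to M.𝟙 ≡ N.𝟙
    pres-<   : ∀ x y → (x M.≺ y) ⇔ (to x N.≺ to y)

{-# OPTIONS --safe #-}

-- Plainness gives every x the residues of some standard integer z x, which is unique
-- because in ℤ two integers a ≠ b already differ modulo 1 + ∣a − b∣. Residues add, so
-- z is a group homomorphism onto ℤ, split by the embedding ι of the standard integers,
-- and x ↦ (x − ι (z x), z x) is a group isomorphism from P onto ker z × ℤ. The kernel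
-- consists of the elements divisible by every n, so it is divisible, and a positive
-- element of the kernel exceeds ι a − ι b for all a, b, because in ℤ every positive
-- multiple of 1 + ∣a − b∣ exceeds a − b; so the order is lexicographic. Each fact about
-- P used here is a first-order sentence true in ℤ, transferred to P.

module Submission where

open import Defs
  renaming ( _`+_ to infixl 6 _`+_ ; _`≈_ to infix 5 _`≈_ ; _`<_ to infix 5 _`<_
           ; _`⇒_ to infixr 3 _`⇒_ ; _`∨_ to infixr 4 _`∨_ )

open import Algebra.Bundles using (AbelianGroup)
import Algebra.Properties.AbelianGroup as AbelianGroupProperties
import Algebra.Properties.CommutativeSemigroup as CommutativeSemigroupProperties
open import Algebra.Structures using (IsAbelianGroup)
import Axiom.UniquenessOfIdentityProofs
open import Data.Fin using () renaming (zero to fz; suc to fs)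
open import Data.Integer as ℤ using (ℤ; +_; -[1+_]; 0ℤ; ∣_∣; _+_; _-_; _*_; -_; _<_; _≤_)
open import Data.Integer.Divisibility.Signed using (_∣_; divides; ∣⇒∣ᵤ)
open import Data.Integer.DivMod using (_/ℕ_; _%ℕ_; n%ℕd<d; a≡a%ℕn+[a/ℕn]*n)
import Data.Integer.Properties as ℤₚ
open import Data.Integer.Tactic.RingSolver using (solve-∀)
open import Data.Nat as ℕ using (ℕ; zero; suc; NonZero)
import Data.Nat.Divisibility as ℕ
import Data.Nat.DivMod as ℕ
import Data.Nat.Properties as ℕₚ
open import Data.Product using (Σ; ∃; _×_; _,_; proj₁; proj₂; map₁; map₂)
open import Data.Sum as Sum using (_⊎_; inj₁; inj₂)
open import Function.Base using (_∘_)
open import Function.Bundles using (_⇔_; mk⇔; Equivalence)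
open import Function.Construct.Identity using (⇔-id)
open import Function.Related.TypeIsomorphisms using (→-cong-⇔)
open import Level using (Level; lift; lower)
open import Relation.Binary.Definitions using (tri<; tri≈; tri>)
open import Relation.Binary.PropositionalEquality
open import Relation.Nullary using (¬_; yes; no; contradiction)
open import Relation.Nullary.Decidable using (decidable-stable)

open Equivalence using (to; from)

Π-cong-⇔ : ∀ {a b c} {A : Set a} {B : A → Set b} {C : A → Set c} →
           (∀ x → B x ⇔ C x) → ((x : A) → B x) ⇔ ((x : A) → C x)
Π-cong-⇔ B⇔C = mk⇔ (λ f x → to (B⇔C x) (f x)) (λ f x → from (B⇔C x) (f x))

-- de Bruijn indices: v₀ is bound by the innermost quantifier.

v₀ : ∀ {n} → Term (suc n)
v₀ = var fz

v₁ : ∀ {n} → Term (suc (suc n))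
v₁ = var (fs fz)

v₂ : ∀ {n} → Term (suc (suc (suc n)))
v₂ = var (fs (fs fz))

infixr 7 _`·_
_`·_ : ∀ {n} → ℕ → Term n → Term n
zero  `· t = `0
suc k `· t = t `+ k `· t

infix 4 `¬_
`¬_ : ∀ {n} → Formula n → Formula n
`¬ φ = φ `⇒ `⊥

⋁ : ∀ {n} → ℕ → (ℕ → Formula n) → Formula n
⋁ zero    φ = `⊥
⋁ (suc k) φ = φ k `∨ ⋁ k φ

weaken : ∀ {n} → Term n → Term (suc n)
weaken (var i)  = var (fs i)
weaken `0       = `0
weaken `1       = `1
weaken (s `+ t) = weaken s `+ weaken t

IsIntegerElemᶠ : ∀ {n} → ℤ → Term n → Formula n
IsIntegerElemᶠ (+ k)    t = t `≈ k `· `1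
IsIntegerElemᶠ -[1+ k ] t = t `+ suc k `· `1 `≈ `0

HasResidueᶠ : ∀ {n} → ℕ → Term n → ℕ → Formula n
HasResidueᶠ n t r = `∃ (weaken t `≈ n `· v₀ `+ r `· `1)

+-assocᶠ +-commᶠ +-identityˡᶠ -‿inverseʳᶠ <-irreflᶠ <-transᶠ <-trichotomyᶠ +-monoˡ-<ᶠ : Sentence
+-assocᶠ       = `∀ (`∀ (`∀ (v₂ `+ v₁ `+ v₀ `≈ v₂ `+ (v₁ `+ v₀))))
+-commᶠ        = `∀ (`∀ (v₁ `+ v₀ `≈ v₀ `+ v₁))
+-identityˡᶠ   = `∀ (`0 `+ v₀ `≈ v₀)
-‿inverseʳᶠ    = `∀ (`∃ (v₁ `+ v₀ `≈ `0))
<-irreflᶠ      = `∀ (`¬ v₀ `< v₀)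
<-transᶠ       = `∀ (`∀ (`∀ (v₂ `< v₁ `⇒ v₁ `< v₀ `⇒ v₂ `< v₀)))
<-trichotomyᶠ  = `∀ (`∀ (v₁ `< v₀ `∨ v₁ `≈ v₀ `∨ v₀ `< v₁))
+-monoˡ-<ᶠ     = `∀ (`∀ (`∀ (v₂ `< v₁ `⇒ v₂ `+ v₀ `< v₁ `+ v₀)))

divisionᶠ : ℕ → Sentence
divisionᶠ n = `∀ (⋁ n (HasResidueᶠ n v₀))

residue-uniqueᶠ : ℕ → ℕ → ℕ → Sentence
residue-uniqueᶠ n r s = `∀ (HasResidueᶠ n v₀ r `⇒ `¬ HasResidueᶠ n v₀ s)

integer-residueᶠ : ∀ n .{{_ : NonZero n}} → ℤ → Sentence
integer-residueᶠ n a = `∀ (IsIntegerElemᶠ a v₀ `⇒ HasResidueᶠ n v₀ (a %ℕ n))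

integer-+ᶠ : ℤ → ℤ → Sentence
integer-+ᶠ a b =
  `∀ (`∀ (IsIntegerElemᶠ a v₁ `⇒ IsIntegerElemᶠ b v₀ `⇒ IsIntegerElemᶠ (a + b) (v₁ `+ v₀)))

integer-<ᶠ : ℤ → ℤ → Sentence
integer-<ᶠ a b = `∀ (`∀ (IsIntegerElemᶠ a v₁ `⇒ IsIntegerElemᶠ b v₀ `⇒ v₁ `< v₀))

multiple-dominatesᶠ : ℕ → ℤ → ℤ → Sentence
multiple-dominatesᶠ n a b = `∀ (`∀ (`∀ (`0 `< v₂ `⇒ HasResidueᶠ n v₂ 0 `⇒
  IsIntegerElemᶠ a v₁ `⇒ IsIntegerElemᶠ b v₀ `⇒ v₁ `< v₂ `+ v₀)))

module _ {ℓ} (M : Structure ℓ) where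
  open Structure M renaming (_⊕_ to infixl 6 _⊕_; _≺_ to infix 4 _≺_)

  env¹ : Carrier → Env M 1
  env¹ x = extend M x (emptyEnv M)

  env² : Carrier → Carrier → Env M 2
  env² x y = extend M y (env¹ x)

  env³ : Carrier → Carrier → Carrier → Env M 3
  env³ x y z = extend M z (env² x y)

  evalT-`· : ∀ {m} (ρ : Env M m) k t → evalT M ρ (k `· t) ≡ _·_ M k (evalT M ρ t)
  evalT-`· ρ zero    t = refl
  evalT-`· ρ (suc k) t = cong (evalT M ρ t ⊕_) (evalT-`· ρ k t)

  evalT-weaken : ∀ {m} (ρ : Env M m) a t → evalT M (extend M a ρ) (weaken t) ≡ evalT M ρ t
  evalT-weaken ρ a (var i)  = refl
  evalT-weaken ρ a `0       = refl
  evalT-weaken ρ a `1       = refl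
  evalT-weaken ρ a (s `+ t) = cong₂ _⊕_ (evalT-weaken ρ a s) (evalT-weaken ρ a t)

  Sat-IsIntegerElemᶠ : ∀ {m} (ρ : Env M m) k t →
                       Sat M ρ (IsIntegerElemᶠ k t) ⇔ IsIntegerElem M k (evalT M ρ t)
  Sat-IsIntegerElemᶠ ρ (+ k) t =
    mk⇔ (λ e → trans e (evalT-`· ρ k `1)) (λ e → trans e (sym (evalT-`· ρ k `1)))
  Sat-IsIntegerElemᶠ ρ -[1+ k ] t =
    mk⇔ (trans (cong (evalT M ρ t ⊕_) (sym (evalT-`· ρ (suc k) `1))))
        (trans (cong (evalT M ρ t ⊕_) (evalT-`· ρ (suc k) `1)))

  Sat-HasResidueᶠ : ∀ {m} (ρ : Env M m) n t r →
                    Sat M ρ (HasResidueᶠ n t r) ⇔ HasResidue M n (evalT M ρ t) r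
  Sat-HasResidueᶠ ρ n t r =
    mk⇔ (map₂ λ {y} e → trans (sym (evalT-weaken ρ y t)) (trans e (residue-term y)))
        (map₂ λ {y} e → trans (evalT-weaken ρ y t) (trans e (sym (residue-term y))))
    where
    residue-term : ∀ y → evalT M (extend M y ρ) (n `· v₀ `+ r `· `1) ≡ _·_ M n y ⊕ _·_ M r 𝟙
    residue-term y = cong₂ _⊕_ (evalT-`· (extend M y ρ) n v₀) (evalT-`· (extend M y ρ) r `1)

  Sat-⋁ : ∀ {m} (ρ : Env M m) k φ → Sat M ρ (⋁ k φ) ⇔ (∃ λ r → r ℕ.< k × Sat M ρ (φ r))
  Sat-⋁ ρ k φ = mk⇔ (choose k) (λ (r , r<k , s) → disjunct k r<k s)
    where
    choose : ∀ k → Sat M ρ (⋁ k φ) → ∃ λ r → r ℕ.< k × Sat M ρ (φ r)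
    choose (suc k) (inj₁ s) = k , ℕₚ.n<1+n k , s
    choose (suc k) (inj₂ s) = map₂ (map₁ ℕₚ.m<n⇒m<1+n) (choose k s)
    disjunct : ∀ k {r} → r ℕ.< k → Sat M ρ (φ r) → Sat M ρ (⋁ k φ)
    disjunct (suc k) {r} r<1+k s with r ℕ.≟ k
    ... | yes refl = inj₁ s
    ... | no r≢k   = inj₂ (disjunct k (ℕₚ.≤∧≢⇒< (ℕₚ.≤-pred r<1+k) r≢k) s)

  ⊨divisionᶠ : ∀ n → M ⊨ divisionᶠ n ⇔ (∀ x → ∃ λ r → r ℕ.< n × HasResidue M n x r)
  ⊨divisionᶠ n = Π-cong-⇔ λ x → mk⇔
    (λ s → map₂ (λ {r} → map₂ (to (residue x r))) (to (Sat-⋁ (env¹ x) n _) s))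
    (λ h → from (Sat-⋁ (env¹ x) n _) (map₂ (λ {r} → map₂ (from (residue x r))) h))
    where
    residue : ∀ x r → Sat M (env¹ x) (HasResidueᶠ n v₀ r) ⇔ HasResidue M n x r
    residue x = Sat-HasResidueᶠ (env¹ x) n v₀

  ⊨residue-uniqueᶠ : ∀ n r s →
    M ⊨ residue-uniqueᶠ n r s ⇔ (∀ x → HasResidue M n x r → ¬ HasResidue M n x s)
  ⊨residue-uniqueᶠ n r s = Π-cong-⇔ λ x →
    →-cong-⇔ (Sat-HasResidueᶠ (env¹ x) n v₀ r)
      (→-cong-⇔ (Sat-HasResidueᶠ (env¹ x) n v₀ s) (mk⇔ lower lift))

  ⊨integer-residueᶠ : ∀ n .{{_ : NonZero n}} a →
    M ⊨ integer-residueᶠ n a ⇔ (∀ u → IsIntegerElem M a u → HasResidue M n u (a %ℕ n))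
  ⊨integer-residueᶠ n a = Π-cong-⇔ λ u →
    →-cong-⇔ (Sat-IsIntegerElemᶠ (env¹ u) a v₀) (Sat-HasResidueᶠ (env¹ u) n v₀ (a %ℕ n))

  ⊨integer-+ᶠ : ∀ a b → M ⊨ integer-+ᶠ a b ⇔
    (∀ u v → IsIntegerElem M a u → IsIntegerElem M b v → IsIntegerElem M (a + b) (u ⊕ v))
  ⊨integer-+ᶠ a b = Π-cong-⇔ λ u → Π-cong-⇔ λ v →
    →-cong-⇔ (Sat-IsIntegerElemᶠ (env² u v) a v₁)
      (→-cong-⇔ (Sat-IsIntegerElemᶠ (env² u v) b v₀)
        (Sat-IsIntegerElemᶠ (env² u v) (a + b) (v₁ `+ v₀)))

  ⊨integer-<ᶠ : ∀ a b → M ⊨ integer-<ᶠ a b ⇔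
    (∀ u v → IsIntegerElem M a u → IsIntegerElem M b v → u ≺ v)
  ⊨integer-<ᶠ a b = Π-cong-⇔ λ u → Π-cong-⇔ λ v →
    →-cong-⇔ (Sat-IsIntegerElemᶠ (env² u v) a v₁)
      (→-cong-⇔ (Sat-IsIntegerElemᶠ (env² u v) b v₀) (⇔-id _))

  ⊨multiple-dominatesᶠ : ∀ n a b → M ⊨ multiple-dominatesᶠ n a b ⇔
    (∀ e u v → 𝟘 ≺ e → HasResidue M n e 0 → IsIntegerElem M a u → IsIntegerElem M b v → u ≺ e ⊕ v)
  ⊨multiple-dominatesᶠ n a b = Π-cong-⇔ λ e → Π-cong-⇔ λ u → Π-cong-⇔ λ v → →-cong-⇔ (⇔-id _)
    (→-cong-⇔ (Sat-HasResidueᶠ (env³ e u v) n v₂ 0)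
      (→-cong-⇔ (Sat-IsIntegerElemᶠ (env³ e u v) a v₁)
        (→-cong-⇔ (Sat-IsIntegerElemᶠ (env³ e u v) b v₀) (⇔-id _))))

open AbelianGroupProperties ℤₚ.+-0-abelianGroup using ()
  renaming (inverseˡ-unique to ℤ-inverseˡ-unique; inverseʳ-unique to ℤ-inverseʳ-unique;
            //-rightDividesˡ to ℤ-[i-j]+j≡i)
open Axiom.UniquenessOfIdentityProofs.Decidable⇒UIP ℤ._≟_ using ()
  renaming (≡-irrelevant to ℤ-≡-irrelevant)

a≡n*[a/ℕn]+a%ℕn : ∀ a n .{{_ : NonZero n}} → a ≡ + n * (a /ℕ n) + + (a %ℕ n)
a≡n*[a/ℕn]+a%ℕn a n = trans (a≡a%ℕn+[a/ℕn]*n a n)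
  (trans (ℤₚ.+-comm (+ (a %ℕ n)) (a /ℕ n * + n)) (cong (_+ + (a %ℕ n)) (ℤₚ.*-comm (a /ℕ n) (+ n))))

[m+r]-[m+s]≡r-s : ∀ m r s → (m + r) - (m + s) ≡ r - s
[m+r]-[m+s]≡r-s = solve-∀

[n*y+s]-[n*x+s]≡[y-x]*n : ∀ n x y s → (n * y + s) - (n * x + s) ≡ (y - x) * n
[n*y+s]-[n*x+s]≡[y-x]*n = solve-∀

i≤+∣i∣ : ∀ i → i ≤ + ∣ i ∣
i≤+∣i∣ (+ n)    = ℤₚ.≤-refl
i≤+∣i∣ -[1+ n ] = ℤ.-≤+

∣i∣<n∧n∣i⇒i≡0 : ∀ {n i} → + n ∣ i → ∣ i ∣ ℕ.< n → i ≡ 0ℤ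
∣i∣<n∧n∣i⇒i≡0 {n} {i} n∣i ∣i∣<n = ℤₚ.∣i∣≡0⇒i≡0 (decidable-stable (∣ i ∣ ℕ.≟ 0)
  λ ∣i∣≢0 → ℕ.>⇒∤ {{ℕ.≢-nonZero ∣i∣≢0}} ∣i∣<n (∣⇒∣ᵤ n∣i))

n∣i∧0<i⇒n≤i : ∀ {n i} → + n ∣ i → 0ℤ < i → + n ≤ i
n∣i∧0<i⇒n≤i {i = + zero}     _   (ℤ.+<+ ())
n∣i∧0<i⇒n≤i {i = ℤ.+[1+ m ]} n∣i _ = ℤ.+≤+ (ℕ.∣⇒≤ (∣⇒∣ᵤ n∣i))

n*x+r≡n*y+s⇒r≡s : ∀ {n r s} x y → r ℕ.< n → s ℕ.< n →
                   + n * x + + r ≡ + n * y + + s → r ≡ s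
n*x+r≡n*y+s⇒r≡s {n} {r} {s} x y r<n s<n eq =
  ℤₚ.+-injective (ℤₚ.i-j≡0⇒i≡j (+ r) (+ s) (∣i∣<n∧n∣i⇒i≡0 (divides (y - x) r-s≡) ∣r-s∣<n))
  where
  r-s≡ : + r - + s ≡ (y - x) * + n
  r-s≡ = begin
    + r - + s                          ≡⟨ [m+r]-[m+s]≡r-s (+ n * x) (+ r) (+ s) ⟨
    (+ n * x + + r) - (+ n * x + + s)  ≡⟨ cong (_- (+ n * x + + s)) eq ⟩
    (+ n * y + + s) - (+ n * x + + s)  ≡⟨ [n*y+s]-[n*x+s]≡[y-x]*n (+ n) x y (+ s) ⟩
    (y - x) * + n                      ∎
    where open ≡-Reasoning
  ∣r-s∣<n : ∣ + r - + s ∣ ℕ.< n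
  ∣r-s∣<n = begin-strict
    ∣ + r - + s ∣  ≡⟨ cong ∣_∣ (ℤₚ.[+m]-[+n]≡m⊖n r s) ⟩
    ∣ r ℤ.⊖ s ∣    ≤⟨ ℤₚ.∣m⊝n∣≤m⊔n r s ⟩
    r ℕ.⊔ s        <⟨ ℕₚ.⊔-lub r<n s<n ⟩
    n              ∎
    where open ℕₚ.≤-Reasoning

a%ℕn≡b%ℕn⇒a≡b : ∀ {n a b} .{{_ : NonZero n}} → ∣ a - b ∣ ℕ.< n → a %ℕ n ≡ b %ℕ n → a ≡ b
a%ℕn≡b%ℕn⇒a≡b {n} {a} {b} ∣a-b∣<n eq =
  ℤₚ.i-j≡0⇒i≡j a b (∣i∣<n∧n∣i⇒i≡0 (divides (p - q) a-b≡) ∣a-b∣<n)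
  where
  open ≡-Reasoning
  p = a /ℕ n
  q = b /ℕ n
  r = a %ℕ n
  a-b≡ : a - b ≡ (p - q) * + n
  a-b≡ = begin
    a - b
      ≡⟨ cong₂ _-_ (a≡n*[a/ℕn]+a%ℕn a n) (a≡n*[a/ℕn]+a%ℕn b n) ⟩
    (+ n * p + + r) - (+ n * q + + (b %ℕ n)) ≡⟨ cong (λ s → (+ n * p + + r) - (+ n * q + + s)) eq ⟨
    (+ n * p + + r) - (+ n * q + + r)       ≡⟨ [n*y+s]-[n*x+s]≡[y-x]*n (+ n) q p (+ r) ⟩
    (p - q) * + n                           ∎

∣a-b∣<n∧n∣e∧0<e⇒a<e+b : ∀ {n a b e} → ∣ a - b ∣ ℕ.< n → 0ℤ < e → + n ∣ e → a < e + b
∣a-b∣<n∧n∣e∧0<e⇒a<e+b {n} {a} {b} {e} ∣a-b∣<n 0<e n∣e =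
  subst (_< e + b) (ℤ-[i-j]+j≡i b a) (ℤₚ.+-monoˡ-< b a-b<e)
  where
  open ℤₚ.≤-Reasoning
  a-b<e : a - b < e
  a-b<e = begin-strict
    a - b         ≤⟨ i≤+∣i∣ (a - b) ⟩
    + ∣ a - b ∣   <⟨ ℤ.+<+ ∣a-b∣<n ⟩
    + n           ≤⟨ n∣i∧0<i⇒n≤i n∣e 0<e ⟩
    e             ∎


ℤ-· : ∀ n y → _·_ ℤ-structure n y ≡ + n * y
ℤ-· zero    y = sym (ℤₚ.*-zeroˡ y)
ℤ-· (suc n) y = trans (cong (_+_ y) (ℤ-· n y)) (sym (ℤₚ.suc-* (+ n) y))

ℤ-·-1 : ∀ n → _·_ ℤ-structure n (+ 1) ≡ + n
ℤ-·-1 n = trans (ℤ-· n (+ 1)) (ℤₚ.*-identityʳ (+ n))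

ℤ-IsIntegerElem : ∀ {k w} → IsIntegerElem ℤ-structure k w ⇔ w ≡ k
ℤ-IsIntegerElem {+ k} = mk⇔ (λ e → trans e (ℤ-·-1 k)) (λ e → trans e (sym (ℤ-·-1 k)))
ℤ-IsIntegerElem { -[1+ k ]} {w} =
  mk⇔ (λ e → ℤ-inverseˡ-unique w (+ suc k) (trans (cong (_+_ w) (sym (ℤ-·-1 (suc k)))) e))
      (λ { refl → trans (cong (_+_ -[1+ k ]) (ℤ-·-1 (suc k))) (ℤₚ.+-inverseˡ (+ suc k)) })

ℤ-HasResidue : ∀ n r {a} → HasResidue ℤ-structure n a r ⇔ (∃ λ q → a ≡ + n * q + + r)
ℤ-HasResidue n r = mk⇔ (map₂ λ e → trans e residue-term) (map₂ λ e → trans e (sym residue-term))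
  where
  residue-term : ∀ {q} → _·_ ℤ-structure n q + _·_ ℤ-structure r (+ 1) ≡ + n * q + + r
  residue-term {q} = cong₂ _+_ (ℤ-· n q) (ℤ-·-1 r)

ℤ-HasResidue-exists : ∀ n .{{_ : NonZero n}} x → ∃ λ r → r ℕ.< n × HasResidue ℤ-structure n x r
ℤ-HasResidue-exists n x =
  x %ℕ n , n%ℕd<d x n , from (ℤ-HasResidue n (x %ℕ n)) (x /ℕ n , a≡n*[a/ℕn]+a%ℕn x n)

ℤ-HasResidue-unique : ∀ {n r s} → r ℕ.< n → s ℕ.< n → r ≢ s →
                      ∀ x → HasResidue ℤ-structure n x r → ¬ HasResidue ℤ-structure n x s
ℤ-HasResidue-unique {n} {r} {s} r<n s<n r≢s x x≡r x≡s
  with to (ℤ-HasResidue n r) x≡r | to (ℤ-HasResidue n s) x≡s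
... | p , x≡np+r | q , x≡nq+s = r≢s (n*x+r≡n*y+s⇒r≡s p q r<n s<n (trans (sym x≡np+r) x≡nq+s))

ℤ-IsIntegerElem-residue : ∀ n .{{_ : NonZero n}} a u →
                          IsIntegerElem ℤ-structure a u → HasResidue ℤ-structure n u (a %ℕ n)
ℤ-IsIntegerElem-residue n a u u≡a =
  from (ℤ-HasResidue n (a %ℕ n)) (a /ℕ n , trans (to ℤ-IsIntegerElem u≡a) (a≡n*[a/ℕn]+a%ℕn a n))

ℤ-IsIntegerElem-+ : ∀ a b u v → IsIntegerElem ℤ-structure a u → IsIntegerElem ℤ-structure b v →
                    IsIntegerElem ℤ-structure (a + b) (u + v)
ℤ-IsIntegerElem-+ a b u v u≡a v≡b =
  from ℤ-IsIntegerElem (cong₂ _+_ (to ℤ-IsIntegerElem u≡a) (to ℤ-IsIntegerElem v≡b))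

ℤ-IsIntegerElem-< : ∀ {a b} → a < b →
                    ∀ u v → IsIntegerElem ℤ-structure a u → IsIntegerElem ℤ-structure b v → u < v
ℤ-IsIntegerElem-< a<b u v u≡a v≡b =
  subst₂ _<_ (sym (to ℤ-IsIntegerElem u≡a)) (sym (to ℤ-IsIntegerElem v≡b)) a<b

ℤ-IsIntegerElem-dominated : ∀ {n a b} → ∣ a - b ∣ ℕ.< n →
  ∀ e u v → 0ℤ < e → HasResidue ℤ-structure n e 0 →
  IsIntegerElem ℤ-structure a u → IsIntegerElem ℤ-structure b v → u < e + v
ℤ-IsIntegerElem-dominated {n} ∣a-b∣<n e u v 0<e e≡0 u≡a v≡b with to (ℤ-HasResidue n 0) e≡0
... | q , e≡nq+0 =
  subst₂ (λ x y → x < e + y) (sym (to ℤ-IsIntegerElem u≡a)) (sym (to ℤ-IsIntegerElem v≡b))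
    (∣a-b∣<n∧n∣e∧0<e⇒a<e+b ∣a-b∣<n 0<e n∣e)
  where
  n∣e : + n ∣ e
  n∣e = divides q (trans e≡nq+0 (trans (ℤₚ.+-identityʳ (+ n * q)) (ℤₚ.*-comm (+ n) q)))

ℤ-<-trichotomy : ∀ a b → a < b ⊎ a ≡ b ⊎ b < a
ℤ-<-trichotomy a b with ℤₚ.<-cmp a b
... | tri< a<b _ _ = inj₁ a<b
... | tri≈ _ a≡b _ = inj₂ (inj₁ a≡b)
... | tri> _ _ b<a = inj₂ (inj₂ b<a)

module PresburgerGroup {ℓ} (P : Structure ℓ) (isPresburger : IsPresburger P) where
  open Structure P renaming (_⊕_ to infixl 6 _⊕_; _≺_ to infix 4 _≺_)

  transfer : ∀ {A : Set} {B : Set ℓ} φ → ℤ-structure ⊨ φ ⇔ A → P ⊨ φ ⇔ B → A → B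
  transfer φ ℤ⊨φ⇔A P⊨φ⇔B a = to P⊨φ⇔B (isPresburger φ (from ℤ⊨φ⇔A a))

  ⊕-assoc : ∀ x y z → x ⊕ y ⊕ z ≡ x ⊕ (y ⊕ z)
  ⊕-assoc = isPresburger +-assocᶠ ℤₚ.+-assoc

  ⊕-comm : ∀ x y → x ⊕ y ≡ y ⊕ x
  ⊕-comm = isPresburger +-commᶠ ℤₚ.+-comm

  ⊕-identityˡ : ∀ x → 𝟘 ⊕ x ≡ x
  ⊕-identityˡ = isPresburger +-identityˡᶠ ℤₚ.+-identityˡ

  ⊖-exists : ∀ x → Σ Carrier λ y → x ⊕ y ≡ 𝟘
  ⊖-exists = isPresburger -‿inverseʳᶠ λ i → - i , ℤₚ.+-inverseʳ i

  infix 8 ⊖_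
  ⊖_ : Carrier → Carrier
  ⊖ x = proj₁ (⊖-exists x)

  ⊖-inverseʳ : ∀ x → x ⊕ ⊖ x ≡ 𝟘
  ⊖-inverseʳ x = proj₂ (⊖-exists x)

  ≺-irrefl : ∀ x → ¬ x ≺ x
  ≺-irrefl x = lower ∘ isPresburger <-irreflᶠ (λ i → lift ∘ ℤₚ.<-irrefl refl) x

  ≺-trans : ∀ {x y z} → x ≺ y → y ≺ z → x ≺ z
  ≺-trans {x} {y} {z} = isPresburger <-transᶠ (λ _ _ _ → ℤₚ.<-trans) x y z

  ≺-trichotomy : ∀ x y → x ≺ y ⊎ x ≡ y ⊎ y ≺ x
  ≺-trichotomy = isPresburger <-trichotomyᶠ ℤ-<-trichotomy

  ⊕-monoˡ-≺ : ∀ z {x y} → x ≺ y → x ⊕ z ≺ y ⊕ z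
  ⊕-monoˡ-≺ z {x} {y} = isPresburger +-monoˡ-<ᶠ (λ _ _ k → ℤₚ.+-monoˡ-< k) x y z

  ⊕-monoʳ-≺ : ∀ z {x y} → x ≺ y → z ⊕ x ≺ z ⊕ y
  ⊕-monoʳ-≺ z {x} {y} x<y = subst₂ _≺_ (⊕-comm x z) (⊕-comm y z) (⊕-monoˡ-≺ z x<y)

  ≺-asym : ∀ {x y} → x ≺ y → ¬ y ≺ x
  ≺-asym {x} x<y y<x = ≺-irrefl x (≺-trans x<y y<x)

  ⊕-isAbelianGroup : IsAbelianGroup _≡_ _⊕_ 𝟘 ⊖_
  ⊕-isAbelianGroup = record
    { isGroup = record
      { isMonoid = record
        { isSemigroup = record
          { isMagma = record { isEquivalence = isEquivalence ; ∙-cong = cong₂ _⊕_ }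
          ; assoc = ⊕-assoc }
        ; identity = ⊕-identityˡ , λ x → trans (⊕-comm x 𝟘) (⊕-identityˡ x) }
      ; inverse = (λ x → trans (⊕-comm (⊖ x) x) (⊖-inverseʳ x)) , ⊖-inverseʳ
      ; ⁻¹-cong = cong ⊖_ }
    ; comm = ⊕-comm }

  ⊕-abelianGroup : AbelianGroup ℓ ℓ
  ⊕-abelianGroup = record { isAbelianGroup = ⊕-isAbelianGroup }

  open AbelianGroup ⊕-abelianGroup using (identityʳ; inverseˡ)
  open AbelianGroupProperties ⊕-abelianGroup
    using (inverseˡ-unique; ⁻¹-∙-comm; //-rightDividesˡ; //-rightDividesʳ; \\-leftDividesˡ)
  open CommutativeSemigroupProperties (AbelianGroup.commutativeSemigroup ⊕-abelianGroup)
    using (interchange)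

  [x+y]-[u+v]≡[x-u]+[y-v] : ∀ x y u v → x ⊕ y ⊕ ⊖ (u ⊕ v) ≡ (x ⊕ ⊖ u) ⊕ (y ⊕ ⊖ v)
  [x+y]-[u+v]≡[x-u]+[y-v] x y u v =
    trans (cong (x ⊕ y ⊕_) (sym (⁻¹-∙-comm u v))) (interchange x y (⊖ u) (⊖ v))

  infixr 7 _·ᴾ_
  _·ᴾ_ : ℕ → Carrier → Carrier
  _·ᴾ_ = _·_ P

  ·ᴾ-homo-+ : ∀ m n x → (m ℕ.+ n) ·ᴾ x ≡ m ·ᴾ x ⊕ n ·ᴾ x
  ·ᴾ-homo-+ zero    n x = sym (⊕-identityˡ (n ·ᴾ x))
  ·ᴾ-homo-+ (suc m) n x = trans (cong (x ⊕_) (·ᴾ-homo-+ m n x)) (sym (⊕-assoc x (m ·ᴾ x) (n ·ᴾ x)))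

  ·ᴾ-assoc : ∀ m n x → (m ℕ.* n) ·ᴾ x ≡ m ·ᴾ n ·ᴾ x
  ·ᴾ-assoc zero    n x = refl
  ·ᴾ-assoc (suc m) n x = trans (·ᴾ-homo-+ n (m ℕ.* n) x) (cong (n ·ᴾ x ⊕_) (·ᴾ-assoc m n x))

  ·ᴾ-distribˡ : ∀ n x y → n ·ᴾ (x ⊕ y) ≡ n ·ᴾ x ⊕ n ·ᴾ y
  ·ᴾ-distribˡ zero    x y = sym (identityʳ 𝟘)
  ·ᴾ-distribˡ (suc n) x y =
    trans (cong (x ⊕ y ⊕_) (·ᴾ-distribˡ n x y)) (interchange x y (n ·ᴾ x) (n ·ᴾ y))

  ·ᴾ-zeroʳ : ∀ n → n ·ᴾ 𝟘 ≡ 𝟘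
  ·ᴾ-zeroʳ zero    = refl
  ·ᴾ-zeroʳ (suc n) = trans (⊕-identityˡ (n ·ᴾ 𝟘)) (·ᴾ-zeroʳ n)

  residue-exists : ∀ n .{{_ : NonZero n}} x → ∃ λ r → r ℕ.< n × HasResidue P n x r
  residue-exists n =
    transfer (divisionᶠ n) (⊨divisionᶠ ℤ-structure n) (⊨divisionᶠ P n) (ℤ-HasResidue-exists n)

  residue-unique : ∀ {n r s x} → r ℕ.< n → s ℕ.< n → HasResidue P n x r → HasResidue P n x s → r ≡ s
  residue-unique {n} {r} {s} {x} r<n s<n x≡r x≡s = decidable-stable (r ℕ.≟ s) λ r≢s →
    transfer (residue-uniqueᶠ n r s) (⊨residue-uniqueᶠ ℤ-structure n r s) (⊨residue-uniqueᶠ P n r s)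
      (ℤ-HasResidue-unique r<n s<n r≢s) x x≡r x≡s

  HasResidue-⊕ : ∀ {n x y r s} → HasResidue P n x r → HasResidue P n y s →
                 HasResidue P n (x ⊕ y) (r ℕ.+ s)
  HasResidue-⊕ {n} {x} {y} {r} {s} (p , x≡) (q , y≡) = p ⊕ q , (begin
    x ⊕ y                              ≡⟨ cong₂ _⊕_ x≡ y≡ ⟩
    n ·ᴾ p ⊕ r ·ᴾ 𝟙 ⊕ (n ·ᴾ q ⊕ s ·ᴾ 𝟙) ≡⟨ interchange (n ·ᴾ p) (r ·ᴾ 𝟙) (n ·ᴾ q) (s ·ᴾ 𝟙) ⟩
    n ·ᴾ p ⊕ n ·ᴾ q ⊕ (r ·ᴾ 𝟙 ⊕ s ·ᴾ 𝟙) ≡⟨ cong₂ _⊕_ (·ᴾ-distribˡ n p q) (·ᴾ-homo-+ r s 𝟙) ⟨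
    n ·ᴾ (p ⊕ q) ⊕ (r ℕ.+ s) ·ᴾ 𝟙       ∎)
    where open ≡-Reasoning

  HasResidue-% : ∀ {n x r} .{{_ : NonZero n}} → HasResidue P n x r → HasResidue P n x (r ℕ.% n)
  HasResidue-% {n} {x} {r} (p , x≡np+r) = p ⊕ q ·ᴾ 𝟙 , (begin
    x                                   ≡⟨ x≡np+r ⟩
    n ·ᴾ p ⊕ r ·ᴾ 𝟙                     ≡⟨ cong (λ k → n ·ᴾ p ⊕ k ·ᴾ 𝟙) r≡nq+m ⟩
    n ·ᴾ p ⊕ (n ℕ.* q ℕ.+ m) ·ᴾ 𝟙       ≡⟨ cong (n ·ᴾ p ⊕_) (·ᴾ-homo-+ (n ℕ.* q) m 𝟙) ⟩
    n ·ᴾ p ⊕ ((n ℕ.* q) ·ᴾ 𝟙 ⊕ m ·ᴾ 𝟙)  ≡⟨ cong (λ u → n ·ᴾ p ⊕ (u ⊕ m ·ᴾ 𝟙)) (·ᴾ-assoc n q 𝟙) ⟩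
    n ·ᴾ p ⊕ (n ·ᴾ q ·ᴾ 𝟙 ⊕ m ·ᴾ 𝟙)     ≡⟨ ⊕-assoc (n ·ᴾ p) (n ·ᴾ q ·ᴾ 𝟙) (m ·ᴾ 𝟙) ⟨
    n ·ᴾ p ⊕ n ·ᴾ q ·ᴾ 𝟙 ⊕ m ·ᴾ 𝟙       ≡⟨ cong (_⊕ m ·ᴾ 𝟙) (·ᴾ-distribˡ n p (q ·ᴾ 𝟙)) ⟨
    n ·ᴾ (p ⊕ q ·ᴾ 𝟙) ⊕ m ·ᴾ 𝟙          ∎)
    where
    open ≡-Reasoning
    q = r ℕ./ n
    m = r ℕ.% n
    r≡nq+m : r ≡ n ℕ.* q ℕ.+ m
    r≡nq+m = trans (ℕ.m≡m%n+[m/n]*n r n)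
      (trans (ℕₚ.+-comm m (q ℕ.* n)) (cong (ℕ._+ m) (ℕₚ.*-comm q n)))

  SameResidues-refl : ∀ {x} → SameResidues P x x
  SameResidues-refl _ _ _ _ = ⇔-id _

  shared-residue⇒same-residues : ∀ {n x y t} → t ℕ.< n → HasResidue P n x t → HasResidue P n y t →
                                 ∀ s → s ℕ.< n → HasResidue P n x s ⇔ HasResidue P n y s
  shared-residue⇒same-residues {n} {x} {y} t<n x≡t y≡t s s<n =
    mk⇔ (λ x≡s → subst (HasResidue P n y) (residue-unique t<n s<n x≡t x≡s) y≡t)
        (λ y≡s → subst (HasResidue P n x) (residue-unique t<n s<n y≡t y≡s) x≡t)

  SameResidues-⊕ : ∀ {x x′ y y′} → SameResidues P x x′ → SameResidues P y y′ →
                   SameResidues P (x ⊕ y) (x′ ⊕ y′)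
  SameResidues-⊕ x~x′ y~y′ zero ()
  SameResidues-⊕ {x} {x′} {y} {y′} x~x′ y~y′ n@(suc _) 0<n
    with residue-exists n x | residue-exists n y
  ... | r , r<n , x≡r | s , s<n , y≡s =
    shared-residue⇒same-residues (ℕ.m%n<n (r ℕ.+ s) n) (residue-of-sum x≡r y≡s)
      (residue-of-sum (to (x~x′ n 0<n r r<n) x≡r) (to (y~y′ n 0<n s s<n) y≡s))
    where
    residue-of-sum : ∀ {u v} → HasResidue P n u r → HasResidue P n v s →
                     HasResidue P n (u ⊕ v) ((r ℕ.+ s) ℕ.% n)
    residue-of-sum u≡r v≡s = HasResidue-% {n} {r = r ℕ.+ s} (HasResidue-⊕ {n} {r = r} {s} u≡r v≡s)

  ι : ℤ → Carrier
  ι (+ k)    = k ·ᴾ 𝟙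
  ι -[1+ k ] = ⊖ (suc k ·ᴾ 𝟙)

  IsIntegerElem⇔≡ι : ∀ {k u} → IsIntegerElem P k u ⇔ u ≡ ι k
  IsIntegerElem⇔≡ι {+ k}      = ⇔-id _
  IsIntegerElem⇔≡ι { -[1+ k ]} {u} =
    mk⇔ (inverseˡ-unique u (suc k ·ᴾ 𝟙)) λ { refl → inverseˡ (suc k ·ᴾ 𝟙) }

  IsIntegerElem-ι : ∀ k → IsIntegerElem P k (ι k)
  IsIntegerElem-ι k = from IsIntegerElem⇔≡ι refl

  ι-+ : ∀ a b → ι (a + b) ≡ ι a ⊕ ι b
  ι-+ a b = sym (to IsIntegerElem⇔≡ι
    (transfer (integer-+ᶠ a b) (⊨integer-+ᶠ ℤ-structure a b) (⊨integer-+ᶠ P a b)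
      (ℤ-IsIntegerElem-+ a b) (ι a) (ι b) (IsIntegerElem-ι a) (IsIntegerElem-ι b)))

  ι-mono-≺ : ∀ {a b} → a < b → ι a ≺ ι b
  ι-mono-≺ {a} {b} a<b =
    transfer (integer-<ᶠ a b) (⊨integer-<ᶠ ℤ-structure a b) (⊨integer-<ᶠ P a b)
      (ℤ-IsIntegerElem-< a<b) (ι a) (ι b) (IsIntegerElem-ι a) (IsIntegerElem-ι b)

  ι-residue : ∀ n .{{_ : NonZero n}} a → HasResidue P n (ι a) (a %ℕ n)
  ι-residue n a =
    transfer (integer-residueᶠ n a) (⊨integer-residueᶠ ℤ-structure n a) (⊨integer-residueᶠ P n a)
      (ℤ-IsIntegerElem-residue n a) (ι a) (IsIntegerElem-ι a)

  ι≺positive-multiple⊕ι : ∀ {n} a b {e} → ∣ a - b ∣ ℕ.< n →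
                          𝟘 ≺ e → HasResidue P n e 0 → ι a ≺ e ⊕ ι b
  ι≺positive-multiple⊕ι {n} a b {e} ∣a-b∣<n 0≺e e≡n·y =
    transfer (multiple-dominatesᶠ n a b) (⊨multiple-dominatesᶠ ℤ-structure n a b)
      (⊨multiple-dominatesᶠ P n a b) (ℤ-IsIntegerElem-dominated ∣a-b∣<n)
      e (ι a) (ι b) 0≺e e≡n·y (IsIntegerElem-ι a) (IsIntegerElem-ι b)

  residues-determine-integer : ∀ {x a b} → SameResidues P x (ι a) → SameResidues P x (ι b) → a ≡ b
  residues-determine-integer {x} {a} {b} x~a x~b =
    a%ℕn≡b%ℕn⇒a≡b (ℕₚ.n<1+n _)
      (residue-unique (n%ℕd<d a n) (n%ℕd<d b n) (residue-of a x~a) (residue-of b x~b))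
    where
    n = suc ∣ a - b ∣
    residue-of : ∀ c → SameResidues P x (ι c) → HasResidue P n x (c %ℕ n)
    residue-of c x~c = from (x~c n ℕ.z<s (c %ℕ n) (n%ℕd<d c n)) (ι-residue n c)

  module _ (plain : Plain P) where

    z : Carrier → ℤ
    z x = proj₁ (plain x)

    SameResidues-ι∘z : ∀ x → SameResidues P x (ι (z x))
    SameResidues-ι∘z x with plain x
    ... | _ , w , w-integer , x~w = subst (SameResidues P x) (to IsIntegerElem⇔≡ι w-integer) x~w

    z-unique : ∀ {x a} → SameResidues P x (ι a) → z x ≡ a
    z-unique = residues-determine-integer (SameResidues-ι∘z _)

    z-ι : ∀ a → z (ι a) ≡ a
    z-ι a = z-unique SameResidues-refl

    z-⊕ : ∀ x y → z (x ⊕ y) ≡ z x + z y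
    z-⊕ x y = z-unique (subst (SameResidues P (x ⊕ y)) (sym (ι-+ (z x) (z y)))
                               (SameResidues-⊕ (SameResidues-ι∘z x) (SameResidues-ι∘z y)))

    z-⊖ : ∀ x → z (⊖ x) ≡ - z x
    z-⊖ x = ℤ-inverseʳ-unique (z x) (z (⊖ x))
      (trans (sym (z-⊕ x (⊖ x))) (trans (cong z (⊖-inverseʳ x)) (z-ι 0ℤ)))

    z-·ᴾ : ∀ n y → z (n ·ᴾ y) ≡ + n * z y
    z-·ᴾ zero    y = trans (z-ι 0ℤ) (sym (ℤₚ.*-zeroˡ (z y)))
    z-·ᴾ (suc n) y =
      trans (z-⊕ y (n ·ᴾ y)) (trans (cong (_+_ (z y)) (z-·ᴾ n y)) (sym (ℤₚ.suc-* (+ n) (z y))))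

    Ker : Set ℓ
    Ker = Σ Carrier λ d → z d ≡ 0ℤ

    Ker-≡ : ∀ {d e : Ker} → proj₁ d ≡ proj₁ e → d ≡ e
    Ker-≡ {d , zd≡0} {.d , zd≡0′} refl = cong (d ,_) (ℤ-≡-irrelevant zd≡0 zd≡0′)

    Ker-residue : ∀ {d} → z d ≡ 0ℤ → ∀ n → 0 ℕ.< n → HasResidue P n d 0
    Ker-residue {d} zd≡0 n 0<n =
      from (d~𝟘 n 0<n 0 0<n) (𝟘 , sym (trans (identityʳ (n ·ᴾ 𝟘)) (·ᴾ-zeroʳ n)))
      where
      d~𝟘 : SameResidues P d 𝟘
      d~𝟘 = subst (SameResidues P d ∘ ι) zd≡0 (SameResidues-ι∘z d)

    _+ᴷ_ : Ker → Ker → Ker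
    (d , zd≡0) +ᴷ (e , ze≡0) = d ⊕ e , trans (z-⊕ d e) (cong₂ _+_ zd≡0 ze≡0)

    0ᴷ : Ker
    0ᴷ = 𝟘 , z-ι 0ℤ

    -ᴷ_ : Ker → Ker
    -ᴷ (d , zd≡0) = ⊖ d , trans (z-⊖ d) (cong -_ zd≡0)

    _<ᴷ_ : Ker → Ker → Set ℓ
    d <ᴷ e = proj₁ d ≺ proj₁ e

    proj₁-times : ∀ n d → proj₁ (times _+ᴷ_ 0ᴷ n d) ≡ n ·ᴾ proj₁ d
    proj₁-times zero    d = refl
    proj₁-times (suc n) d = cong (proj₁ d ⊕_) (proj₁-times n d)

    Ker-divisible : ∀ n → 0 ℕ.< n → ∀ d → Σ Ker λ e → times _+ᴷ_ 0ᴷ n e ≡ d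
    Ker-divisible n 0<n (d , zd≡0) = divide (Ker-residue zd≡0 n 0<n)
      where
      divide : HasResidue P n d 0 → Σ Ker λ e → times _+ᴷ_ 0ᴷ n e ≡ (d , zd≡0)
      divide (y , d≡ny+0) = (y , zy≡0) , Ker-≡ (trans (proj₁-times n (y , zy≡0)) (sym d≡ny))
        where
        d≡ny : d ≡ n ·ᴾ y
        d≡ny = trans d≡ny+0 (identityʳ (n ·ᴾ y))
        n*zy≡0 : + n * z y ≡ 0ℤ
        n*zy≡0 = trans (sym (z-·ᴾ n y)) (trans (cong z (sym d≡ny)) zd≡0)
        zy≡0 : z y ≡ 0ℤ
        zy≡0 = ℤₚ.*-cancelˡ-≡ (+ n) (z y) 0ℤ {{ℕ.>-nonZero 0<n}}
          (trans n*zy≡0 (sym (ℤₚ.*-zeroʳ (+ n))))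

    Ker-trichotomy : ∀ d e → d <ᴷ e ⊎ d ≡ e ⊎ e <ᴷ d
    Ker-trichotomy d e = Sum.map₂ (Sum.map₁ Ker-≡) (≺-trichotomy (proj₁ d) (proj₁ e))

    V : DivisibleOrderedAbelianGroup ℓ
    V = record
      { Carrier      = Ker
      ; _+_          = _+ᴷ_
      ; 0#           = 0ᴷ
      ; -_           = -ᴷ_
      ; _<_          = _<ᴷ_
      ; +-assoc      = λ d e f → Ker-≡ (⊕-assoc (proj₁ d) (proj₁ e) (proj₁ f))
      ; +-comm       = λ d e → Ker-≡ (⊕-comm (proj₁ d) (proj₁ e))
      ; +-identityˡ  = λ d → Ker-≡ (⊕-identityˡ (proj₁ d))
      ; -‿inverseˡ   = λ d → Ker-≡ (inverseˡ (proj₁ d))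
      ; <-irrefl     = λ d → ≺-irrefl (proj₁ d)
      ; <-trans      = ≺-trans
      ; <-trichotomy = Ker-trichotomy
      ; +-mono-<     = λ f → ⊕-monoˡ-≺ (proj₁ f)
      ; divisible    = Ker-divisible
      }

    Ker-dominates : ∀ {d e} → z d ≡ 0ℤ → z e ≡ 0ℤ → d ≺ e → ∀ a b → d ⊕ ι a ≺ e ⊕ ι b
    Ker-dominates {d} {e} zd≡0 ze≡0 d≺e a b =
      subst (d ⊕ ι a ≺_) d+[[e-d]+ιb]≡e+ιb (⊕-monoʳ-≺ d ιa≺[e-d]+ιb)
      where
      e-d : Ker
      e-d = (-ᴷ (d , zd≡0)) +ᴷ (e , ze≡0)
      0≺e-d : 𝟘 ≺ ⊖ d ⊕ e
      0≺e-d = subst (_≺ ⊖ d ⊕ e) (inverseˡ d) (⊕-monoʳ-≺ (⊖ d) d≺e)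
      ιa≺[e-d]+ιb : ι a ≺ ⊖ d ⊕ e ⊕ ι b
      ιa≺[e-d]+ιb = ι≺positive-multiple⊕ι a b (ℕₚ.n<1+n _) 0≺e-d
        (Ker-residue (proj₂ e-d) (suc ∣ a - b ∣) ℕ.z<s)
      d+[[e-d]+ιb]≡e+ιb : d ⊕ (⊖ d ⊕ e ⊕ ι b) ≡ e ⊕ ι b
      d+[[e-d]+ιb]≡e+ιb =
        trans (sym (⊕-assoc d (⊖ d ⊕ e) (ι b))) (cong (_⊕ ι b) (\\-leftDividesˡ d e))

    module N = Structure (V ×ℤ)

    divisible-part : Carrier → Carrier
    divisible-part x = x ⊕ ⊖ ι (z x)

    z-divisible-part : ∀ x → z (divisible-part x) ≡ 0ℤ
    z-divisible-part x = begin
      z (x ⊕ ⊖ ι (z x))       ≡⟨ z-⊕ x (⊖ ι (z x)) ⟩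
      z x + z (⊖ ι (z x))     ≡⟨ cong (_+_ (z x)) (trans (z-⊖ (ι (z x))) (cong -_ (z-ι (z x)))) ⟩
      z x - z x               ≡⟨ ℤₚ.+-inverseʳ (z x) ⟩
      0ℤ                      ∎
      where open ≡-Reasoning

    split : Carrier → Ker × ℤ
    split x = (divisible-part x , z-divisible-part x) , z x

    join : Ker × ℤ → Carrier
    join ((d , _) , k) = d ⊕ ι k

    join∘split : ∀ x → join (split x) ≡ x
    join∘split x = //-rightDividesˡ (ι (z x)) x

    split∘join : ∀ p → split (join p) ≡ p
    split∘join ((d , zd≡0) , k) =
      cong₂ _,_ (Ker-≡ (trans (cong (λ j → d ⊕ ι k ⊕ ⊖ ι j) z[d+ιk]≡k) (//-rightDividesʳ (ι k) d)))
                z[d+ιk]≡k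
      where
      z[d+ιk]≡k : z (d ⊕ ι k) ≡ k
      z[d+ιk]≡k = trans (z-⊕ d (ι k)) (trans (cong₂ _+_ zd≡0 (z-ι k)) (ℤₚ.+-identityˡ k))

    split-⊕ : ∀ x y → split (x ⊕ y) ≡ split x N.⊕ split y
    split-⊕ x y = cong₂ _,_ (Ker-≡ (begin
      x ⊕ y ⊕ ⊖ ι (z (x ⊕ y))              ≡⟨ cong (λ k → x ⊕ y ⊕ ⊖ ι k) (z-⊕ x y) ⟩
      x ⊕ y ⊕ ⊖ ι (z x + z y)              ≡⟨ cong (λ u → x ⊕ y ⊕ ⊖ u) (ι-+ (z x) (z y)) ⟩
      x ⊕ y ⊕ ⊖ (ι (z x) ⊕ ι (z y))        ≡⟨ [x+y]-[u+v]≡[x-u]+[y-v] x y (ι (z x)) (ι (z y)) ⟩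
      divisible-part x ⊕ divisible-part y  ∎)) (z-⊕ x y)
      where open ≡-Reasoning

    split-ι : ∀ k → split (ι k) ≡ (0ᴷ , k)
    split-ι k = trans (cong split (sym (⊕-identityˡ (ι k)))) (split∘join (0ᴷ , k))

    join-mono : ∀ p q → p N.≺ q → join p ≺ join q
    join-mono ((d , zd≡0) , a) ((e , ze≡0) , b) (inj₁ d≺e)  = Ker-dominates zd≡0 ze≡0 d≺e a b
    join-mono ((d , _) , a) (_ , b) (inj₂ (refl , lift a<b)) = ⊕-monoʳ-≺ d (ι-mono-≺ a<b)

    join-reflects : ∀ p q → join p ≺ join q → p N.≺ q
    join-reflects p@(d , a) q@(e , b) jp≺jq with Ker-trichotomy d e
    ... | inj₁ d≺e         = inj₁ d≺e
    ... | inj₂ (inj₂ e≺d)  = contradiction (join-mono q p (inj₁ e≺d)) (≺-asym jp≺jq)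
    ... | inj₂ (inj₁ refl) with ℤ-<-trichotomy a b
    ...   | inj₁ a<b         = inj₂ (refl , lift a<b)
    ...   | inj₂ (inj₁ refl) = contradiction jp≺jq (≺-irrefl (join p))
    ...   | inj₂ (inj₂ b<a)  = contradiction (join-mono q p (inj₂ (refl , lift b<a))) (≺-asym jp≺jq)

    split-≺ : ∀ x y → x ≺ y ⇔ split x N.≺ split y
    split-≺ x y = subst₂ (λ u v → u ≺ v ⇔ split x N.≺ split y) (join∘split x) (join∘split y)
      (mk⇔ (join-reflects (split x) (split y)) (join-mono (split x) (split y)))

    P≅V×ℤ : P ≅ (V ×ℤ)
    P≅V×ℤ = record
      { to      = split
      ; from    = join
      ; from∘to = join∘split
      ; to∘from = split∘join
      ; pres-+  = split-⊕
      ; pres-0  = split-ι 0ℤ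
      ; pres-1  = trans (cong split (sym (identityʳ 𝟙))) (split-ι (+ 1))
      ; pres-<  = split-≺
      }

proposition2p16 : ∀ {ℓ : Level} (P : Structure ℓ) → IsPresburger P → Plain P →
    Σ (DivisibleOrderedAbelianGroup ℓ) λ V → P ≅ (V ×ℤ)
proposition2p16 P isPresburger plain = V plain , P≅V×ℤ plain
  where open PresburgerGroup P isPresburger
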